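{- For $n,m\ge 2$ and $k\ge 1$ integers, $$\varepsilon_S\Big(m,\frac{n}{k},k\Big)>\varepsilon_S\Big(m,\frac{n}{k+1},k+1\Big).$$
   Context: For $m\ge1$, $k\ge1$ and real $\nu>0$ with $\nu k$ a nonnegative integer, let $X$ be the classic occupancy number of $\nu k$ balls cast independently and uniformly into $m$ urns (number of occupied urns), and let $f_S(m,\nu,k)=\mathbb{E}[(X/m)^k]$ (the false-positive rate of an $m$-bit standard Bloom filter storing $\nu$ items with $k$ independent uniform hash positions each). The efficiency is $\varepsilon_S(m,\nu,k)=-\frac{\nu}{m}\log_2 f_S(m,\nu,k)$. -}

module Defs where

open import Data.Nat as ℕ using (ℕ; zero; suc; NonZero)
open import Data.Nat.Properties using (m^n≢0)
open import Data.Fin using (Fin)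
open import Data.Fin.Properties using (_≟_)
open import Data.Vec using (Vec; []; _∷_)
open import Data.Vec.Relation.Unary.Any using (any?)
open import Data.List using (List; []; _∷_; [_]; map; concatMap; allFin; filter; length)
open import Data.Integer using (+_)
open import Data.Rational using (ℚ; _/_; _+_; _*_; 0ℚ; 1ℚ)

_^ℚ_ : ℚ → ℕ → ℚ
p ^ℚ zero    = 1ℚ
p ^ℚ (suc k) = p * (p ^ℚ k)

sumℚ : List ℚ → ℚ
sumℚ []       = 0ℚ
sumℚ (x ∷ xs) = x + sumℚ xs

-- all m^b equally likely outcomes of casting b labelled balls into m urns
-- (the i-th coordinate is the urn of ball i)
outcomes : (m b : ℕ) → List (Vec (Fin m) b)
outcomes m zero    = [ [] ]
outcomes m (suc b) = concatMap (λ i → map (i ∷_) (outcomes m b)) (allFin m)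

occupied : {m b : ℕ} → Vec (Fin m) b → ℕ
occupied {m} v = length (filter (λ i → any? (i ≟_) v) (allFin m))

-- f_S(m, ν, k) with b = ν k balls: E[(X/m)^k] under the uniform distribution
-- on outcomes (probability 1/m^b each).
fS : (m b k : ℕ) → .{{_ : NonZero m}} → ℚ
fS m b k = (+ 1 / (m ℕ.^ b)) {{m^n≢0 m b}}
           * sumℚ (map (λ v → ((+ occupied v) / m) ^ℚ k) (outcomes m b))

module Submission where

-- Let X be the occupancy of an outcome and s j the sum of X ^ j over the m ^ n equally likely
-- outcomes, so that fS m n k = s k / m ^ (n + k) and s 0 = m ^ n.  Clearing denominators, the
-- claim is Lyapunov's inequality s k ^ (k + 1) < s (k + 1) ^ k * s 0 for the moments of X.  It
-- follows by induction on k from strict log-convexity s (j + 1) ^ 2 < s j * s (j + 2), which is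
-- the Cauchy–Schwarz inequality for the weights X ^ j; it is strict because, as n, m ≥ 2, X takes
-- the two distinct positive values 1 (all balls in one urn) and 2.

module Moments where

  open import Data.Nat
  open import Data.Nat.Properties
  open import Data.Nat.ListAction using (sum)
  open import Data.Nat.Solver using (module +-*-Solver)
  open import Data.List using (List; []; _∷_; map; length)
  open import Data.List.Membership.Propositional using (_∈_)
  open import Data.List.Relation.Unary.Any using (here; there)
  open import Algebra.Properties.CommutativeSemigroup *-commutativeSemigroup using (interchange)
  open import Function using (id; _∘_)
  open import Relation.Binary.PropositionalEquality
  open import Relation.Nullary using (contradiction)
  open +-*-Solver

  ^-distribʳ-* : ∀ m n o → (m * n) ^ o ≡ m ^ o * n ^ o
  ^-distribʳ-* m n zero    = refl
  ^-distribʳ-* m n (suc o) = begin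
    m * n * (m * n) ^ o      ≡⟨ cong (m * n *_) (^-distribʳ-* m n o) ⟩
    m * n * (m ^ o * n ^ o)  ≡⟨ interchange m n (m ^ o) (n ^ o) ⟩
    m * m ^ o * (n * n ^ o)  ∎
    where open ≡-Reasoning

  2xy+∣x-y∣²≡x²+y² : ∀ x y → 2 * (x * y) + ∣ x - y ∣ * ∣ x - y ∣ ≡ x * x + y * y
  2xy+∣x-y∣²≡x²+y² zero    y       = refl
  2xy+∣x-y∣²≡x²+y² (suc x) zero    =
    solve 1 (λ x → con 2 :* (x :* con 0) :+ x :* x := x :* x :+ con 0) refl (suc x)
  2xy+∣x-y∣²≡x²+y² (suc x) (suc y) = begin
    2 * (suc x * suc y) + d * d              ≡⟨ solve 3 (λ x y d → con 2 :* ((con 1 :+ x) :* (con 1 :+ y)) :+ d :* d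
                                                   := (con 2 :* (x :* y) :+ d :* d) :+ con 2 :* (con 1 :+ x :+ y)) refl x y d ⟩
    (2 * (x * y) + d * d) + 2 * (1 + x + y)  ≡⟨ cong (_+ 2 * (1 + x + y)) (2xy+∣x-y∣²≡x²+y² x y) ⟩
    (x * x + y * y) + 2 * (1 + x + y)        ≡⟨ solve 2 (λ x y → (x :* x :+ y :* y) :+ con 2 :* (con 1 :+ x :+ y)
                                                   := (con 1 :+ x) :* (con 1 :+ x) :+ (con 1 :+ y) :* (con 1 :+ y)) refl x y ⟩
    suc x * suc x + suc y * suc y            ∎
    where
    open ≡-Reasoning
    d : ℕ
    d = ∣ x - y ∣

  am-gm : ∀ x y → 2 * (x * y) ≤ x * x + y * y
  am-gm x y = subst (2 * (x * y) ≤_) (2xy+∣x-y∣²≡x²+y² x y) (m≤m+n _ _)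

  am-gm-< : ∀ {x y} → x ≢ y → 2 * (x * y) < x * x + y * y
  am-gm-< {x} {y} x≢y = subst (2 * (x * y) <_) (2xy+∣x-y∣²≡x²+y² x y) (m<m+n _ (*-mono-< d>0 d>0))
    where
    d>0 : 0 < ∣ x - y ∣
    d>0 = n≢0⇒n>0 (x≢y ∘ ∣m-n∣≡0⇒m≡n)

  module WeightedCauchySchwarz {ℓ} {A : Set ℓ} (w x : A → ℕ) where

    μ : ℕ → A → ℕ
    μ i a = w a * x a ^ i

    M : ℕ → List A → ℕ
    M i as = sum (map (μ i) as)

    private
      pair-lhs : ∀ a b → 2 * (μ 1 a * μ 1 b) ≡ w a * w b * (2 * (x a * x b))
      pair-lhs a b = solve 4 (λ u v s t → con 2 :* ((u :* (s :* con 1)) :* (v :* (t :* con 1)))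
                                         := u :* v :* (con 2 :* (s :* t))) refl (w a) (w b) (x a) (x b)

      pair-rhs : ∀ a b → μ 0 a * μ 2 b + μ 2 a * μ 0 b ≡ w a * w b * (x a * x a + x b * x b)
      pair-rhs a b = solve 4 (λ u v s t → (u :* con 1) :* (v :* (t :* (t :* con 1))) :+ (u :* (s :* (s :* con 1))) :* (v :* con 1)
                                         := u :* v :* (s :* s :+ t :* t)) refl (w a) (w b) (x a) (x b)

    pair-≤ : ∀ a b → 2 * (μ 1 a * μ 1 b) ≤ μ 0 a * μ 2 b + μ 2 a * μ 0 b
    pair-≤ a b = subst₂ _≤_ (sym (pair-lhs a b)) (sym (pair-rhs a b)) (*-monoʳ-≤ (w a * w b) (am-gm (x a) (x b)))

    pair-< : ∀ {a b} .{{_ : NonZero (w a)}} .{{_ : NonZero (w b)}} → x a ≢ x b →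
             2 * (μ 1 a * μ 1 b) < μ 0 a * μ 2 b + μ 2 a * μ 0 b
    pair-< {a} {b} xa≢xb = subst₂ _<_ (sym (pair-lhs a b)) (sym (pair-rhs a b))
      (*-monoʳ-< (w a * w b) {{m*n≢0 (w a) (w b)}} (am-gm-< xa≢xb))

    private
      cross-nil : ∀ a → 2 * (μ 1 a * 0) ≡ μ 0 a * 0 + μ 2 a * 0
      cross-nil a = solve 3 (λ p q r → con 2 :* (p :* con 0) := q :* con 0 :+ r :* con 0) refl (μ 1 a) (μ 0 a) (μ 2 a)

      cross-∷ : ∀ {r} (_R_ : ℕ → ℕ → Set r) a b bs →
                (2 * (μ 1 a * μ 1 b) + 2 * (μ 1 a * M 1 bs)) R ((μ 0 a * μ 2 b + μ 2 a * μ 0 b) + (μ 0 a * M 2 bs + μ 2 a * M 0 bs)) →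
                (2 * (μ 1 a * M 1 (b ∷ bs))) R (μ 0 a * M 2 (b ∷ bs) + μ 2 a * M 0 (b ∷ bs))
      cross-∷ _R_ a b bs = subst₂ _R_
        (solve 3 (λ p q Q → con 2 :* (p :* q) :+ con 2 :* (p :* Q) := con 2 :* (p :* (q :+ Q))) refl (μ 1 a) (μ 1 b) (M 1 bs))
        (solve 6 (λ u t v V s S → (u :* v :+ t :* s) :+ (u :* V :+ t :* S) := u :* (v :+ V) :+ t :* (s :+ S))
               refl (μ 0 a) (μ 2 a) (μ 2 b) (M 2 bs) (μ 0 b) (M 0 bs))

    cross-≤ : ∀ a bs → 2 * (μ 1 a * M 1 bs) ≤ μ 0 a * M 2 bs + μ 2 a * M 0 bs
    cross-≤ a []       = ≤-reflexive (cross-nil a)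
    cross-≤ a (b ∷ bs) = cross-∷ _≤_ a b bs (+-mono-≤ (pair-≤ a b) (cross-≤ a bs))

    cross-< : ∀ a {b bs} → b ∈ bs → .{{_ : NonZero (w a)}} .{{_ : NonZero (w b)}} → x a ≢ x b →
              2 * (μ 1 a * M 1 bs) < μ 0 a * M 2 bs + μ 2 a * M 0 bs
    cross-< a {bs = b ∷ bs} (here refl)  xa≢xb = cross-∷ _<_ a b bs (+-mono-<-≤ (pair-< xa≢xb) (cross-≤ a bs))
    cross-< a {bs = c ∷ bs} (there b∈bs) xa≢xb = cross-∷ _<_ a c bs (+-mono-≤-< (pair-≤ a c) (cross-< a b∈bs xa≢xb))

    private
      square-∷ : ∀ {r} (_R_ : ℕ → ℕ → Set r) a as →
                 (μ 0 a * μ 2 a + 2 * (μ 1 a * M 1 as) + M 1 as * M 1 as) R (μ 0 a * μ 2 a + (μ 0 a * M 2 as + μ 2 a * M 0 as) + M 0 as * M 2 as) →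
                 (M 1 (a ∷ as) * M 1 (a ∷ as)) R (M 0 (a ∷ as) * M 2 (a ∷ as))
      square-∷ _R_ a as = subst₂ _R_
        (solve 3 (λ u s S → (u :* con 1) :* (u :* (s :* (s :* con 1))) :+ con 2 :* (u :* (s :* con 1) :* S) :+ S :* S
                          := (u :* (s :* con 1) :+ S) :* (u :* (s :* con 1) :+ S)) refl (w a) (x a) (M 1 as))
        (solve 4 (λ u U t T → u :* t :+ (u :* T :+ t :* U) :+ U :* T := (u :+ U) :* (t :+ T)) refl (μ 0 a) (M 0 as) (μ 2 a) (M 2 as))

    cauchy-schwarz : ∀ as → M 1 as * M 1 as ≤ M 0 as * M 2 as
    cauchy-schwarz []       = z≤n
    cauchy-schwarz (a ∷ as) = square-∷ _≤_ a as (+-mono-≤ (+-monoʳ-≤ (μ 0 a * μ 2 a) (cross-≤ a as)) (cauchy-schwarz as))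

    cauchy-schwarz-< : ∀ {a b as} → a ∈ as → b ∈ as → .{{_ : NonZero (w a)}} .{{_ : NonZero (w b)}} → x a ≢ x b →
                       M 1 as * M 1 as < M 0 as * M 2 as
    cauchy-schwarz-< (here refl) (here refl) xa≢xb = contradiction refl xa≢xb
    cauchy-schwarz-< {as = a ∷ as} (here refl) (there b∈as) xa≢xb =
      square-∷ _<_ a as (+-mono-<-≤ (+-monoʳ-< (μ 0 a * μ 2 a) (cross-< a b∈as xa≢xb)) (cauchy-schwarz as))
    cauchy-schwarz-< {as = b ∷ as} (there a∈as) (here refl) xa≢xb =
      square-∷ _<_ b as (+-mono-<-≤ (+-monoʳ-< (μ 0 b * μ 2 b) (cross-< b a∈as (xa≢xb ∘ sym))) (cauchy-schwarz as))
    cauchy-schwarz-< {as = c ∷ as} (there a∈as) (there b∈as) xa≢xb =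
      square-∷ _<_ c as (+-mono-≤-< (+-monoʳ-≤ (μ 0 c * μ 2 c) (cross-≤ c as)) (cauchy-schwarz-< a∈as b∈as xa≢xb))

  powerSum : ℕ → List ℕ → ℕ
  powerSum j xs = sum (map (_^ j) xs)

  powerSum-zero : ∀ xs → powerSum 0 xs ≡ length xs
  powerSum-zero []       = refl
  powerSum-zero (x ∷ xs) = cong suc (powerSum-zero xs)

  module PowerWeighted (j : ℕ) = WeightedCauchySchwarz (_^ j) id

  moment≡powerSum : ∀ j i xs → PowerWeighted.M j i xs ≡ powerSum (i + j) xs
  moment≡powerSum j i []       = refl
  moment≡powerSum j i (x ∷ xs) = cong₂ _+_
    (trans (*-comm (x ^ j) (x ^ i)) (sym (^-distribˡ-+-* x i j))) (moment≡powerSum j i xs)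

  powerSum-logConvex-< : ∀ j {x y xs} → x ∈ xs → y ∈ xs → .{{_ : NonZero x}} → .{{_ : NonZero y}} → x ≢ y →
                         powerSum (suc j) xs * powerSum (suc j) xs < powerSum j xs * powerSum (2 + j) xs
  powerSum-logConvex-< j {x} {y} {xs} x∈xs y∈xs x≢y =
    subst₂ _<_ (cong₂ _*_ (moment≡powerSum j 1 xs) (moment≡powerSum j 1 xs))
               (cong₂ _*_ (moment≡powerSum j 0 xs) (moment≡powerSum j 2 xs))
               (PowerWeighted.cauchy-schwarz-< j x∈xs y∈xs {{m^n≢0 x j}} {{m^n≢0 y j}} x≢y)

  lyapunov-step : ∀ {a b c s₀} k → b * b < a * c → a ^ suc k ≤ b ^ k * s₀ → b ^ (2 + k) < c ^ suc k * s₀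
  lyapunov-step {a} {b} {c} {s₀} k b²<ac aᵏ⁺¹≤bᵏs₀ = *-cancelˡ-< (b ^ k) _ _ (begin-strict
    b ^ k * b ^ (2 + k)       ≡⟨ solve 2 (λ b bᵏ → bᵏ :* (b :* (b :* bᵏ)) := (b :* bᵏ) :* (b :* bᵏ)) refl b (b ^ k) ⟩
    b ^ suc k * b ^ suc k     ≡⟨ ^-distribʳ-* b b (suc k) ⟨
    (b * b) ^ suc k           <⟨ ^-monoˡ-< (suc k) b²<ac ⟩
    (a * c) ^ suc k           ≡⟨ ^-distribʳ-* a c (suc k) ⟩
    a ^ suc k * c ^ suc k     ≤⟨ *-monoˡ-≤ (c ^ suc k) aᵏ⁺¹≤bᵏs₀ ⟩
    b ^ k * s₀ * c ^ suc k    ≡⟨ solve 3 (λ p q r → p :* q :* r := p :* (r :* q)) refl (b ^ k) s₀ (c ^ suc k) ⟩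
    b ^ k * (c ^ suc k * s₀)  ∎)
    where open ≤-Reasoning

  module Lyapunov (s : ℕ → ℕ) (logConvex : ∀ j → s (suc j) * s (suc j) < s j * s (2 + j)) where

    lyapunov-≤ : ∀ k → s k ^ suc k ≤ s (suc k) ^ k * s 0
    lyapunov-< : ∀ k → s (suc k) ^ (2 + k) < s (2 + k) ^ suc k * s 0

    lyapunov-≤ zero    = ≤-reflexive (*-comm (s 0) 1)
    lyapunov-≤ (suc k) = <⇒≤ (lyapunov-< k)

    lyapunov-< k = lyapunov-step {s k} {s (suc k)} {s (2 + k)} k (logConvex k) (lyapunov-≤ k)

  -- The Lyapunov inequality cross-multiplied as (a / m ^ (n + k)) ^ suc k < (b / m ^ (n + suc k)) ^ k.
  cross-multiply-< : ∀ a b m n k .{{_ : NonZero m}} → a ^ suc k < b ^ k * m ^ n →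
                     a ^ suc k * m ^ ((n + suc k) * k) < b ^ k * m ^ ((n + k) * suc k)
  cross-multiply-< a b m n k aᵏ⁺¹<bᵏmⁿ = begin-strict
    a ^ suc k * m ^ e                   <⟨ *-monoˡ-< (m ^ e) {{m^n≢0 m e}} aᵏ⁺¹<bᵏmⁿ ⟩
    b ^ k * m ^ n * m ^ e               ≡⟨ *-assoc (b ^ k) (m ^ n) (m ^ e) ⟩
    b ^ k * (m ^ n * m ^ e)             ≡⟨ cong (b ^ k *_) (^-distribˡ-+-* m n e) ⟨
    b ^ k * m ^ (n + e)                 ≡⟨ cong (λ e → b ^ k * m ^ e) (solve 2 (λ n k → n :+ (n :+ (con 1 :+ k)) :* k := (n :+ k) :* (con 1 :+ k)) refl n k) ⟩
    b ^ k * m ^ ((n + k) * suc k)       ∎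
    where
    open ≤-Reasoning
    e : ℕ
    e = (n + suc k) * k

module Fractions where

  open import Defs using (_^ℚ_; sumℚ)
  open import Data.Nat as ℕ using (ℕ; zero; suc; NonZero)
  import Data.Nat.Properties as ℕ
  open import Data.Nat.ListAction using (sum)
  open import Data.Integer as ℤ using (+_; +<+)
  import Data.Integer.Properties as ℤ
  open import Data.Rational using (ℚ; _/_; _+_; _*_; _<_; toℚᵘ)
  open import Data.Rational.Properties using (toℚᵘ-injective; toℚᵘ-fromℚᵘ; toℚᵘ-homo-*; toℚᵘ-homo-+; toℚᵘ-cancel-<; 0/n≡0)
  import Data.Rational.Unnormalised as ℚᵘ
  import Data.Rational.Unnormalised.Properties as ℚᵘ
  open import Data.List using ([]; _∷_; map)
  open import Relation.Binary.PropositionalEquality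

  toℚᵘ-/ : ∀ i d .{{_ : NonZero d}} → toℚᵘ (i / d) ℚᵘ.≃ i ℚᵘ./ d
  toℚᵘ-/ i (suc d) = toℚᵘ-fromℚᵘ (ℚᵘ.mkℚᵘ i d)

  /ᵘ-*-/ᵘ : ∀ i j d e .{{_ : NonZero d}} .{{_ : NonZero e}} → (i ℚᵘ./ d) ℚᵘ.* (j ℚᵘ./ e) ℚᵘ.≃ ((i ℤ.* j) ℚᵘ./ (d ℕ.* e)) {{ℕ.m*n≢0 d e}}
  /ᵘ-*-/ᵘ i j (suc d) (suc e) = ℚᵘ.≃-refl

  /ᵘ-+-/ᵘ : ∀ i j d .{{_ : NonZero d}} → (i ℚᵘ./ d) ℚᵘ.+ (j ℚᵘ./ d) ℚᵘ.≃ (i ℤ.+ j) ℚᵘ./ d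
  /ᵘ-+-/ᵘ i j d@(suc _) = begin-equality
    (i ℤ.* + d ℤ.+ j ℤ.* + d) ℚᵘ./ (d ℕ.* d)  ≡⟨ cong (ℚᵘ._/ (d ℕ.* d)) (ℤ.*-distribʳ-+ (+ d) i j) ⟨
    ((i ℤ.+ j) ℤ.* + d) ℚᵘ./ (d ℕ.* d)        ≃⟨ ℚᵘ.*-cancelʳ-/ d ⟩
    (i ℤ.+ j) ℚᵘ./ d                          ∎
    where open ℚᵘ.≤-Reasoning

  /ᵘ-<-/ᵘ : ∀ {i j d e} .{{_ : NonZero d}} .{{_ : NonZero e}} → i ℤ.* + e ℤ.< j ℤ.* + d → i ℚᵘ./ d ℚᵘ.< j ℚᵘ./ e
  /ᵘ-<-/ᵘ {d = suc _} {e = suc _} = ℚᵘ.*<*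

  -- Both proofs pass over toℚᵘ (+ a / d) ℚᵘ.* toℚᵘ (+ b / e) (resp. ℚᵘ.+) in one step: written
  -- out as a step of the chain, it makes Agda unfold the gcd normalisation inside ℚ._/_.
  /-*-/ : ∀ a b d e .{{_ : NonZero d}} .{{_ : NonZero e}} → (+ a / d) * (+ b / e) ≡ (+ (a ℕ.* b) / (d ℕ.* e)) {{ℕ.m*n≢0 d e}}
  /-*-/ a b d e = toℚᵘ-injective (begin-equality
    toℚᵘ ((+ a / d) * (+ b / e))    ≃⟨ ℚᵘ.≃-trans (toℚᵘ-homo-* (+ a / d) (+ b / e)) (ℚᵘ.*-cong (toℚᵘ-/ (+ a) d) (toℚᵘ-/ (+ b) e)) ⟩
    (+ a ℚᵘ./ d) ℚᵘ.* (+ b ℚᵘ./ e)  ≃⟨ /ᵘ-*-/ᵘ (+ a) (+ b) d e ⟩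
    (+ a ℤ.* + b) ℚᵘ./ (d ℕ.* e)    ≡⟨ cong (ℚᵘ._/ (d ℕ.* e)) (ℤ.pos-* a b) ⟨
    + (a ℕ.* b) ℚᵘ./ (d ℕ.* e)      ≃⟨ toℚᵘ-/ (+ (a ℕ.* b)) (d ℕ.* e) ⟨
    toℚᵘ (+ (a ℕ.* b) / (d ℕ.* e))  ∎)
    where
    open ℚᵘ.≤-Reasoning
    instance
      de≢0 : NonZero (d ℕ.* e)
      de≢0 = ℕ.m*n≢0 d e

  /-+-/ : ∀ a b d .{{_ : NonZero d}} → (+ a / d) + (+ b / d) ≡ + (a ℕ.+ b) / d
  /-+-/ a b d = toℚᵘ-injective (begin-equality
    toℚᵘ ((+ a / d) + (+ b / d))    ≃⟨ ℚᵘ.≃-trans (toℚᵘ-homo-+ (+ a / d) (+ b / d)) (ℚᵘ.+-cong (toℚᵘ-/ (+ a) d) (toℚᵘ-/ (+ b) d)) ⟩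
    (+ a ℚᵘ./ d) ℚᵘ.+ (+ b ℚᵘ./ d)  ≃⟨ /ᵘ-+-/ᵘ (+ a) (+ b) d ⟩
    (+ a ℤ.+ + b) ℚᵘ./ d            ≡⟨ cong (ℚᵘ._/ d) (ℤ.pos-+ a b) ⟨
    + (a ℕ.+ b) ℚᵘ./ d              ≃⟨ toℚᵘ-/ (+ (a ℕ.+ b)) d ⟨
    toℚᵘ (+ (a ℕ.+ b) / d)          ∎)
    where open ℚᵘ.≤-Reasoning

  /-^ℚ : ∀ a d k .{{_ : NonZero d}} → (+ a / d) ^ℚ k ≡ (+ (a ℕ.^ k) / (d ℕ.^ k)) {{ℕ.m^n≢0 d k}}
  /-^ℚ a d zero    = toℚᵘ-injective (ℚᵘ.≃-sym (toℚᵘ-/ (+ 1) 1))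
  /-^ℚ a d (suc k) = trans (cong (+ a / d *_) (/-^ℚ a d k)) (/-*-/ a (a ℕ.^ k) d (d ℕ.^ k))
    where
    instance
      dᵏ≢0 : NonZero (d ℕ.^ k)
      dᵏ≢0 = ℕ.m^n≢0 d k

  sumℚ-/ : ∀ {A : Set} (f : A → ℚ) (g : A → ℕ) d .{{_ : NonZero d}} → (∀ x → f x ≡ + g x / d) →
           ∀ xs → sumℚ (map f xs) ≡ + sum (map g xs) / d
  sumℚ-/ f g d f≡g/d []       = sym (0/n≡0 d)
  sumℚ-/ f g d f≡g/d (x ∷ xs) = trans (cong₂ _+_ (f≡g/d x) (sumℚ-/ f g d f≡g/d xs)) (/-+-/ (g x) (sum (map g xs)) d)

  /-<-/ : ∀ a b d e .{{_ : NonZero d}} .{{_ : NonZero e}} → a ℕ.* e ℕ.< b ℕ.* d → + a / d < + b / e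
  /-<-/ a b d e ae<bd = toℚᵘ-cancel-< (begin-strict
    toℚᵘ (+ a / d)  ≃⟨ toℚᵘ-/ (+ a) d ⟩
    + a ℚᵘ./ d      <⟨ /ᵘ-<-/ᵘ (subst₂ ℤ._<_ (ℤ.pos-* a e) (ℤ.pos-* b d) (+<+ ae<bd)) ⟩
    + b ℚᵘ./ e      ≃⟨ toℚᵘ-/ (+ b) e ⟨
    toℚᵘ (+ b / e)  ∎)
    where open ℚᵘ.≤-Reasoning

module Occupancy where

  open import Defs using (outcomes; occupied)
  open Moments using (powerSum; powerSum-zero; powerSum-logConvex-<; module Lyapunov)
  open import Data.Nat hiding (_≟_)
  open import Data.Fin using (Fin; zero; suc)
  open import Data.Fin.Properties using (_≟_)
  open import Data.Vec using (Vec; []; _∷_; replicate)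
  open import Data.Vec.Relation.Unary.Any using (Any; there; any?)
  open import Data.List using (List; []; _∷_; map; concatMap; allFin; length)
  open import Data.List.Properties using (length-++; length-map; length-tabulate; filter-none)
  open import Data.List.Membership.Propositional using (_∈_)
  open import Data.List.Membership.Propositional.Properties using (∈-map⁺; ∈-concatMap⁺; ∈-allFin)
  import Data.List.Relation.Unary.Any as List
  open import Data.List.Relation.Unary.All.Properties using (tabulate⁺)
  open import Relation.Binary.PropositionalEquality
  open import Relation.Nullary using (¬_)

  length-concatMap : ∀ {a b} {A : Set a} {B : Set b} {f : A → List B} {c} → (∀ x → length (f x) ≡ c) →
                     ∀ xs → length (concatMap f xs) ≡ length xs * c
  length-concatMap ∣fx∣≡c []       = refl
  length-concatMap {f = f} ∣fx∣≡c (x ∷ xs) =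
    trans (length-++ (f x)) (cong₂ _+_ (∣fx∣≡c x) (length-concatMap ∣fx∣≡c xs))

  length-outcomes : ∀ m b → length (outcomes m b) ≡ m ^ b
  length-outcomes m zero    = refl
  length-outcomes m (suc b) = begin
    length (outcomes m (suc b))  ≡⟨ length-concatMap {f = extend} (λ i → trans (length-map (i ∷_) (outcomes m b)) (length-outcomes m b)) (allFin m) ⟩
    length (allFin m) * m ^ b    ≡⟨ cong (_* m ^ b) (length-tabulate {n = m} (λ i → i)) ⟩
    m * m ^ b                    ∎
    where
    open ≡-Reasoning
    extend : Fin m → List (Vec (Fin m) (suc b))
    extend i = map (i ∷_) (outcomes m b)

  ∈-outcomes : ∀ {m b} (v : Vec (Fin m) b) → v ∈ outcomes m b
  ∈-outcomes []       = List.here refl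
  ∈-outcomes {m} {suc b} (i ∷ v) =
    ∈-concatMap⁺ (λ j → map (j ∷_) (outcomes m b)) (List.map (λ { refl → ∈-map⁺ (i ∷_) (∈-outcomes v) }) (∈-allFin i))

  occupied-replicate : ∀ {m} b → occupied {suc m} (replicate (suc b) zero) ≡ 1
  occupied-replicate {m} b =
    cong suc (cong length (filter-none (λ i → any? (i ≟_) (replicate (suc b) zero)) (tabulate⁺ (λ i → suc∉replicate i (suc b)))))
    where
    suc∉replicate : ∀ (i : Fin m) n → ¬ Any (suc i ≡_) (replicate n zero)
    suc∉replicate i (suc n) (there p) = suc∉replicate i n p

  occupancies : ℕ → ℕ → List ℕ
  occupancies m b = map occupied (outcomes m b)

  powerSum-zero-occupancies : ∀ m b → powerSum 0 (occupancies m b) ≡ m ^ b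
  powerSum-zero-occupancies m b =
    trans (powerSum-zero (occupancies m b)) (trans (length-map occupied (outcomes m b)) (length-outcomes m b))

  occupancies-logConvex-< : ∀ {m b} → 2 ≤ m → 2 ≤ b → ∀ j →
    powerSum (suc j) (occupancies m b) * powerSum (suc j) (occupancies m b) <
    powerSum j (occupancies m b) * powerSum (2 + j) (occupancies m b)
  occupancies-logConvex-< {suc (suc m)} {suc (suc b)} (s≤s (s≤s z≤n)) (s≤s (s≤s z≤n)) j =
    powerSum-logConvex-< j 1∈occupancies (∈-map⁺ occupied (∈-outcomes twoUrns)) λ ()
    where
    1∈occupancies : 1 ∈ occupancies (2 + m) (2 + b)
    1∈occupancies = subst (_∈ occupancies (2 + m) (2 + b)) (occupied-replicate {suc m} (suc b))
      (∈-map⁺ occupied (∈-outcomes (replicate (2 + b) zero)))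

    twoUrns : Vec (Fin (2 + m)) (2 + b)
    twoUrns = zero ∷ suc zero ∷ replicate b zero

  occupancies-lyapunov : ∀ {m b} → 2 ≤ m → 2 ≤ b → ∀ k →
    powerSum (suc k) (occupancies m b) ^ (2 + k) < powerSum (2 + k) (occupancies m b) ^ suc k * m ^ b
  occupancies-lyapunov {m} {b} 2≤m 2≤b k =
    subst (λ N → s (suc k) ^ (2 + k) < s (2 + k) ^ suc k * N) (powerSum-zero-occupancies m b)
      (Lyapunov.lyapunov-< s (occupancies-logConvex-< 2≤m 2≤b) k)
    where
    s : ℕ → ℕ
    s j = powerSum j (occupancies m b)

open import Defs
open import Data.Nat using (ℕ; zero; suc; NonZero; _≤_; _+_; _*_; _^_)
open import Data.Nat.Properties using (m^n≢0; m*n≢0; *-identityˡ; ^-distribˡ-+-*; ^-*-assoc)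
open import Data.Nat.ListAction using (sum)
open import Data.Integer using (+_)
open import Data.Rational using (_/_; _<_)
import Data.Rational as ℚ
open import Data.Rational.Properties using (/-cong; module ≤-Reasoning)
open import Data.List using (List; map)
open import Data.Vec using (Vec)
open import Data.Fin using (Fin)
open import Data.List.Properties using (map-∘)
open import Function using (_∘_)
open import Relation.Binary.PropositionalEquality using (_≡_; refl; sym; trans; cong; module ≡-Reasoning)
open Moments using (powerSum; cross-multiply-<)
open Fractions using (/-*-/; /-^ℚ; sumℚ-/; /-<-/)
open Occupancy using (occupancies; occupancies-lyapunov)

fS≡powerSum/ : ∀ m b k .{{_ : NonZero m}} → fS m b k ≡ (+ powerSum k (occupancies m b) / m ^ (b + k)) {{m^n≢0 m (b + k)}}
fS≡powerSum/ m b k = begin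
  fS m b k                                      ≡⟨ cong ((+ 1 / m ^ b) ℚ.*_) (sumℚ-/ _ occupied↑k (m ^ k) (λ v → /-^ℚ (occupied v) m k) L) ⟩
  (+ 1 / m ^ b) ℚ.* (+ S / m ^ k)               ≡⟨ /-*-/ 1 S (m ^ b) (m ^ k) ⟩
  + (1 * S) / (m ^ b * m ^ k)                   ≡⟨ /-cong (cong +_ (trans (*-identityˡ S) (cong sum (map-∘ L)))) (sym (^-distribˡ-+-* m b k)) ⟩
  + powerSum k (occupancies m b) / m ^ (b + k)  ∎
  where
  open ≡-Reasoning
  L : List (Vec (Fin m) b)
  L = outcomes m b
  occupied↑k : Vec (Fin m) b → ℕ
  occupied↑k = (_^ k) ∘ occupied
  S : ℕ
  S = sum (map occupied↑k L)
  instance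
    mᵇ≢0 : NonZero (m ^ b)
    mᵇ≢0 = m^n≢0 m b
    mᵏ≢0 : NonZero (m ^ k)
    mᵏ≢0 = m^n≢0 m k
    mᵇmᵏ≢0 : NonZero (m ^ b * m ^ k)
    mᵇmᵏ≢0 = m*n≢0 (m ^ b) (m ^ k)
    mᵇ⁺ᵏ≢0 : NonZero (m ^ (b + k))
    mᵇ⁺ᵏ≢0 = m^n≢0 m (b + k)

fS-^ℚ : ∀ m b k e .{{_ : NonZero m}} →
        fS m b k ^ℚ e ≡ (+ (powerSum k (occupancies m b) ^ e) / m ^ ((b + k) * e)) {{m^n≢0 m ((b + k) * e)}}
fS-^ℚ m b k e = begin
  fS m b k ^ℚ e                   ≡⟨ cong (_^ℚ e) (fS≡powerSum/ m b k) ⟩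
  (+ s / m ^ (b + k)) ^ℚ e        ≡⟨ /-^ℚ s (m ^ (b + k)) e ⟩
  + (s ^ e) / (m ^ (b + k)) ^ e   ≡⟨ /-cong (refl {x = + (s ^ e)}) (^-*-assoc m (b + k) e) ⟩
  + (s ^ e) / m ^ ((b + k) * e)   ∎
  where
  open ≡-Reasoning
  s : ℕ
  s = powerSum k (occupancies m b)
  instance
    mᵇ⁺ᵏ≢0 : NonZero (m ^ (b + k))
    mᵇ⁺ᵏ≢0 = m^n≢0 m (b + k)
    mᵇ⁺ᵏᵉ≢0 : NonZero ((m ^ (b + k)) ^ e)
    mᵇ⁺ᵏᵉ≢0 = m^n≢0 (m ^ (b + k)) e
    m⁽ᵇ⁺ᵏ⁾ᵉ≢0 : NonZero (m ^ ((b + k) * e))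
    m⁽ᵇ⁺ᵏ⁾ᵉ≢0 = m^n≢0 m ((b + k) * e)

theorem4p2 : (n m k : ℕ) → .{{_ : NonZero m}} → 2 ≤ n → 2 ≤ m → 1 ≤ k →
    (fS m n k ^ℚ suc k) < (fS m n (suc k) ^ℚ k)
theorem4p2 n m zero    _   _   ()
theorem4p2 n m (suc k) 2≤n 2≤m _ = begin-strict
  fS m n (suc k) ^ℚ (2 + k)  ≡⟨ fS-^ℚ m n (suc k) (2 + k) ⟩
  + x / d                    <⟨ /-<-/ x y d e (cross-multiply-< (s (suc k)) (s (2 + k)) m n (suc k) (occupancies-lyapunov 2≤m 2≤n k)) ⟩
  + y / e                    ≡⟨ fS-^ℚ m n (2 + k) (suc k) ⟨
  fS m n (2 + k) ^ℚ suc k    ∎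
  where
  open ≤-Reasoning
  s : ℕ → ℕ
  s j = powerSum j (occupancies m n)
  x y d e : ℕ
  x = s (suc k) ^ (2 + k)
  y = s (2 + k) ^ suc k
  d = m ^ ((n + suc k) * (2 + k))
  e = m ^ ((n + (2 + k)) * suc k)
  instance
    d≢0 : NonZero d
    d≢0 = m^n≢0 m ((n + suc k) * (2 + k))
    e≢0 : NonZero e
    e≢0 = m^n≢0 m ((n + (2 + k)) * suc k)
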